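{- (1) If $t\in\{x_0,x_1,\dots\}\cup\{0,1\}$, then $t$ can be computed by a finite and test-free thread that uses 1 auxiliary variable. (2) If $t$ can be computed by a finite and test-free thread that uses $n$ auxiliary variables, then so can $-t$ and $t^{ -1}$. (3) Suppose meadow terms $t,t'$ with variables among the input variables can be computed by finite and test-free threads that use $n$ and $m$ auxiliary variables, respectively. If $n=m$, then $t+t'$ and $t\cdot t'$ can be computed by finite and test-free threads that use $n+1$ auxiliary variables; if $n\neq m$, then $t+t'$ and $t\cdot t'$ can be computed by finite and test-free threads that use $\max\{n,m\}$ auxiliary variables.
   Context: A meadow is a commutative ring with unit with a total unary $x\mapsto x^{ -1}$ satisfying $(x^{ -1})^{ -1}=x$ and $x\cdot(x\cdot x^{ -1})=x$; a cancellation meadow additionally satisfies $x\neq0\rightarrow x\cdot x^{ -1}=1$. Meadow terms are terms over $(0,1,+,\cdot,-,{}^{ -1})$. Variables: input $x_0,x_1,\dots$, auxiliary $a_0,a_1,\dots$, output $y$. Actions: assignments $a_i.\mathtt{cp}(x_j)$ ($a_i:=x_j$), $a_i.\mathtt{set{:}0}$, $a_i.\mathtt{set{:}1}$, $a_i.\mathtt{set{:}ai}$ ($a_i:=-a_i$), $a_i.\mathtt{set{:}mi}$ ($a_i:=a_i^{ -1}$), $a_i.\mathtt{set{:}a}(a_j)$ ($a_i:=a_i+a_j$), $a_i.\mathtt{set{:}m}(a_j)$ ($a_i:=a_i\cdot a_j$), $y.\mathtt{cp}(a_j)$ ($y:=a_j$), and tests $a_i.\mathtt{test{:}0}$. Finite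 threads: $\mathsf{S}$, $\mathsf{D}$, $T_1\trianglelefteq\mathtt{a}\trianglerighteq T_2$ (perform $\mathtt{a}$, continue as $T_1$ on reply $\mathtt{true}$, $T_2$ on $\mathtt{false}$); $\mathtt{a}\circ T$ abbreviates $T\trianglelefteq\mathtt{a}\trianglerighteq T$. A thread is test-free if postconditional composition occurs only as $\mathtt{a}\circ T$. A thread uses $n$ auxiliary variables if the auxiliary variables in its actions are precisely $a_0,\dots,a_{n-1}$. $[\![T]\!]^k_{\mathcal{M}}(m_0,\dots,m_k)$ is the value of $y$ after running $T$ from the state with $x_i=m_i$ ($i\le k$) and all other variables $0$, if the run ends in $\mathsf{S}$, and undefined otherwise. A thread $T$ computes a meadow term $t$ with variables among $x_0,\dots,x_k$ if for all cancellation meadows $\mathcal{M}$ and all $m_0,\dots,m_k\in\mathcal{M}$, $[\![T]\!]^k_{\mathcal{M}}(m_0,\dots,m_k)$ equals the value of $t$ under $x_i\mapsto m_i$. -}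

module Defs where

open import Level using (Level)
import Data.Fin as Fin
open import Data.Nat using (ℕ; zero; suc; _<_; _≟_)
open import Data.Fin using (Fin)
open import Data.Bool using (Bool; true; false)
open import Data.Product using (Σ; ∃; _×_; _,_)
open import Relation.Nullary using (¬_; yes; no)
open import Relation.Binary.PropositionalEquality using (_≡_)
open import Algebra.Structures using (IsCommutativeRing)
open import Function.Bundles using (_⇔_)

record Meadow (c : Level) : Set (Level.suc c) where
  infixl 7 _*_
  infixl 6 _+_
  field
    Carrier : Set c
    _+_ _*_ : Carrier → Carrier → Carrier
    -_      : Carrier → Carrier
    0# 1#   : Carrier
    _⁻¹     : Carrier → Carrier
    isCommutativeRing : IsCommutativeRing _≡_ _+_ _*_ -_ 0# 1#
    ⁻¹-involutive : ∀ x → (x ⁻¹) ⁻¹ ≡ x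
    ril           : ∀ x → x * (x * x ⁻¹) ≡ x

record CancellationMeadow (c : Level) : Set (Level.suc c) where
  field
    meadow : Meadow c
  open Meadow meadow public
  field
    cancellation : ∀ x → ¬ (x ≡ 0#) → x * x ⁻¹ ≡ 1#

data Term (n : ℕ) : Set where
  var  : Fin n → Term n
  𝟎 𝟏  : Term n
  _⊕_ _⊗_ : Term n → Term n → Term n
  ⊖_   : Term n → Term n
  _⁻¹ᵗ : Term n → Term n

module _ {c} (M : CancellationMeadow c) where
  open CancellationMeadow M

  eval : ∀ {n} → Term n → (Fin n → Carrier) → Carrier
  eval (var i)  ρ = ρ i
  eval 𝟎        ρ = 0#
  eval 𝟏        ρ = 1#
  eval (t ⊕ u)  ρ = eval t ρ + eval u ρ
  eval (t ⊗ u)  ρ = eval t ρ * eval u ρ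
  eval (⊖ t)    ρ = - eval t ρ
  eval (t ⁻¹ᵗ)  ρ = eval t ρ ⁻¹

-- Basic actions (auxiliary variable a_i is represented by i : ℕ,
-- input variable x_j by j : ℕ)

data Action : Set where
  cp    : (i j : ℕ) → Action   -- a_i.cp(x_j)     a_i := x_j
  set0  : (i : ℕ) → Action     -- a_i.set:0       a_i := 0
  set1  : (i : ℕ) → Action     -- a_i.set:1       a_i := 1
  setai : (i : ℕ) → Action     -- a_i.set:ai      a_i := - a_i
  setmi : (i : ℕ) → Action     -- a_i.set:mi      a_i := a_i ⁻¹
  seta  : (i j : ℕ) → Action   -- a_i.set:a(a_j)  a_i := a_i + a_j
  setm  : (i j : ℕ) → Action   -- a_i.set:m(a_j)  a_i := a_i · a_j
  ycp   : (j : ℕ) → Action     -- y.cp(a_j)       y := a_j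
  test0 : (i : ℕ) → Action

data MentionsAux : ℕ → Action → Set where
  m-cp    : ∀ {i j} → MentionsAux i (cp i j)
  m-set0  : ∀ {i} → MentionsAux i (set0 i)
  m-set1  : ∀ {i} → MentionsAux i (set1 i)
  m-setai : ∀ {i} → MentionsAux i (setai i)
  m-setmi : ∀ {i} → MentionsAux i (setmi i)
  m-setaˡ : ∀ {i j} → MentionsAux i (seta i j)
  m-setaʳ : ∀ {i j} → MentionsAux j (seta i j)
  m-setmˡ : ∀ {i j} → MentionsAux i (setm i j)
  m-setmʳ : ∀ {i j} → MentionsAux j (setm i j)
  m-ycp   : ∀ {j} → MentionsAux j (ycp j)
  m-test0 : ∀ {i} → MentionsAux i (test0 i)

data Thread : Set where
  S D : Thread
  _⊴_⊵_ : Thread → Action → Thread → Thread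

_∘ᵗ_ : Action → Thread → Thread
a ∘ᵗ T = T ⊴ a ⊵ T

data TestFree : Thread → Set where
  tf-S : TestFree S
  tf-D : TestFree D
  tf-∘ : ∀ {a T} → TestFree T → TestFree (a ∘ᵗ T)

data OccursAux (i : ℕ) : Thread → Set where
  here  : ∀ {T₁ a T₂} → MentionsAux i a → OccursAux i (T₁ ⊴ a ⊵ T₂)
  left  : ∀ {T₁ a T₂} → OccursAux i T₁ → OccursAux i (T₁ ⊴ a ⊵ T₂)
  right : ∀ {T₁ a T₂} → OccursAux i T₂ → OccursAux i (T₁ ⊴ a ⊵ T₂)

UsesAux : ℕ → Thread → Set
UsesAux n T = ∀ i → (OccursAux i T ⇔ i < n)

module Semantics {c} (M : CancellationMeadow c) where
  open CancellationMeadow M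

  record State : Set c where
    constructor st
    field
      xv : ℕ → Carrier
      av : ℕ → Carrier
      yv : Carrier
  open State public

  upd : (ℕ → Carrier) → ℕ → Carrier → ℕ → Carrier
  upd f i v j with j ≟ i
  ... | yes _ = v
  ... | no  _ = f j

  setA : State → ℕ → Carrier → State
  setA σ i v = st (xv σ) (upd (av σ) i v) (yv σ)

  effect : Action → State → State
  effect (cp i j)   σ = setA σ i (xv σ j)
  effect (set0 i)   σ = setA σ i 0#
  effect (set1 i)   σ = setA σ i 1#
  effect (setai i)  σ = setA σ i (- av σ i)
  effect (setmi i)  σ = setA σ i (av σ i ⁻¹)
  effect (seta i j) σ = setA σ i (av σ i + av σ j)
  effect (setm i j) σ = setA σ i (av σ i * av σ j)
  effect (ycp j)    σ = st (xv σ) (av σ) (av σ j)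
  effect (test0 i)  σ = σ

  data Reply : Action → State → Bool → Set c where
    r-cp    : ∀ {i j σ} → Reply (cp i j) σ true
    r-set0  : ∀ {i σ} → Reply (set0 i) σ true
    r-set1  : ∀ {i σ} → Reply (set1 i) σ true
    r-setai : ∀ {i σ} → Reply (setai i) σ true
    r-setmi : ∀ {i σ} → Reply (setmi i) σ true
    r-seta  : ∀ {i j σ} → Reply (seta i j) σ true
    r-setm  : ∀ {i j σ} → Reply (setm i j) σ true
    r-ycp   : ∀ {j σ} → Reply (ycp j) σ true
    r-t0    : ∀ {i σ} → av σ i ≡ 0# → Reply (test0 i) σ true
    r-t0ᶠ   : ∀ {i σ} → ¬ (av σ i ≡ 0#) → Reply (test0 i) σ false

  data Run : Thread → State → State → Set c where
    run-S : ∀ {σ} → Run S σ σ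
    run-t : ∀ {T₁ a T₂ σ σ'} → Reply a σ true →
            Run T₁ (effect a σ) σ' → Run (T₁ ⊴ a ⊵ T₂) σ σ'
    run-f : ∀ {T₁ a T₂ σ σ'} → Reply a σ false →
            Run T₂ (effect a σ) σ' → Run (T₁ ⊴ a ⊵ T₂) σ σ'

  -- input assignment x_i = m_i for i < n, other x_i = 0
  inputs : ∀ {n} → (Fin n → Carrier) → ℕ → Carrier
  inputs {zero}  m i       = 0#
  inputs {suc n} m zero    = m Fin.zero
  inputs {suc n} m (suc i) = inputs (λ j → m (Fin.suc j)) i

  initial : ∀ {n} → (Fin n → Carrier) → State
  initial m = st (inputs m) (λ _ → 0#) 0#

  Denotes : ∀ {k} → Thread → (Fin (suc k) → Carrier) → Carrier → Set c
  Denotes T m v = Σ State λ σ' → Run T (initial m) σ' × yv σ' ≡ v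

Computes : (c : Level) (k : ℕ) → Thread → Term (suc k) → Set (Level.suc c)
Computes c k T t =
  (M : CancellationMeadow c) (m : Fin (suc k) → CancellationMeadow.Carrier M) →
  Semantics.Denotes M T m (eval M t m)

ComputableWith : (c : Level) (k : ℕ) → ℕ → Term (suc k) → Set (Level.suc c)
ComputableWith c k n t = ∃ λ T → TestFree T × UsesAux n T × Computes c k T t

-- A test-free thread is a straight-line program, so its output is the value that its last
-- action y.cp(a_j) reads from a_j (or 0 if y is never written).  Dropping the tests and
-- outputs, cutting the program just before that action, and remembering j gives a "loader"
-- for t: straight-line code that, from any state whose auxiliary variables below n are 0,
-- leaves the value of t in register a_j.  Loaders are closed under the term operations:
-- -t and t⁻¹ act on the register in place, while for t ∘ t′ the value of the first loader
-- is parked in a register a_r above every variable of the second one, the variables below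
-- r are cleared, the second loader runs and a_r absorbs its result.  Prefixing a loader with
-- a_{n-1}.set:0, …, a_0.set:0 makes every auxiliary variable below n occur, without changing
-- anything when started from the initial state.

module Submission where

open import Defs
open import Level using (Level)
open import Algebra.Structures using (IsCommutativeRing)
open import Data.Bool using (true)
open import Data.Empty using (⊥-elim)
open import Data.Fin using (Fin)
import Data.Fin as Fin
open import Data.List using (List; []; _∷_; _++_; foldl; foldr)
open import Data.List.Properties using (foldl-++)
open import Data.List.Relation.Unary.All using (All; []; _∷_) renaming (map to All-map)
open import Data.List.Relation.Unary.All.Properties using (++⁺; ++⁻)
open import Data.Maybe using (Maybe; just; nothing)
open import Data.Maybe.Relation.Unary.All as Maybe using (just; nothing)
open import Data.Nat using (ℕ; zero; suc; _⊔_; _<_; _≤_; _≟_; s≤s; z≤n)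
open import Data.Nat.Properties
  using (≤-refl; ≤-trans; <-≤-trans; n≤1+n; <⇒≤; <⇒≢; <-cmp; m≤n⇒m<n∨m≡n;
         m≤n⇒m⊔n≡n; m≥n⇒m⊔n≡m)
open import Data.Product using (Σ; _×_; _,_)
open import Data.Sum using (inj₁; inj₂)
open import Function using (_∘_)
open import Function.Bundles using (mk⇔; Equivalence)
open import Relation.Binary.Definitions using (tri<; tri≈; tri>)
open import Relation.Binary.PropositionalEquality
  using (_≡_; _≢_; refl; sym; trans; cong; cong₂; subst; module ≡-Reasoning)
open import Relation.Nullary using (¬_; yes; no)

-- Tests are never kept in the constructed threads: a run through a_i.test:0 needs its reply,
-- i.e. a decision of a_i = 0, which a cancellation meadow need not provide.
data Assignment : Set where
  cp seta setm            : (i j : ℕ) → Assignment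
  set0 set1 setai setmi   : (i : ℕ) → Assignment

⌜_⌝ : Assignment → Action
⌜ cp i j ⌝   = cp i j
⌜ seta i j ⌝ = seta i j
⌜ setm i j ⌝ = setm i j
⌜ set0 i ⌝   = set0 i
⌜ set1 i ⌝   = set1 i
⌜ setai i ⌝  = setai i
⌜ setmi i ⌝  = setmi i

target : Assignment → ℕ
target (cp i _)   = i
target (seta i _) = i
target (setm i _) = i
target (set0 i)   = i
target (set1 i)   = i
target (setai i)  = i
target (setmi i)  = i

Bounded : ℕ → Action → Set
Bounded n a = ∀ {i} → MentionsAux i a → i < n

BoundedCode : ℕ → List Assignment → Set
BoundedCode n = All (Bounded n ∘ ⌜_⌝)

target-bounded : ∀ {n} a → Bounded n ⌜ a ⌝ → target a < n
target-bounded (cp i j)   b = b m-cp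
target-bounded (seta i j) b = b m-setaˡ
target-bounded (setm i j) b = b m-setmˡ
target-bounded (set0 i)   b = b m-set0
target-bounded (set1 i)   b = b m-set1
target-bounded (setai i)  b = b m-setai
target-bounded (setmi i)  b = b m-setmi

BoundedCode-weaken : ∀ {n B} → n ≤ B → ∀ {as} → BoundedCode n as → BoundedCode B as
BoundedCode-weaken n≤B = All-map (λ b {i} m → <-≤-trans (b m) n≤B)

clear : ℕ → List Assignment
clear zero    = []
clear (suc n) = set0 n ∷ clear n

clear-bounded : ∀ n {B} → n ≤ B → BoundedCode B (clear n)
clear-bounded zero    _   = []
clear-bounded (suc n) n<B = (λ { m-set0 → n<B }) ∷ clear-bounded n (≤-trans (n≤1+n n) n<B)

-- a_r := a_j, reading 0 when there is no register; clearing a_r first would lose a_j when j = r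
transfer : ℕ → Maybe ℕ → List Assignment
transfer r nothing = set0 r ∷ []
transfer r (just j) with j ≟ r
... | yes _ = []
... | no _  = set0 r ∷ seta r j ∷ []

transfer-bounded : ∀ {B r reg} → Maybe.All (_< B) reg → r < B → BoundedCode B (transfer r reg)
transfer-bounded {r = r} nothing r<B = (λ { m-set0 → r<B }) ∷ []
transfer-bounded {r = r} (just {j} j<B) r<B with j ≟ r
... | yes _ = []
... | no _  = (λ { m-set0 → r<B }) ∷ (λ { m-setaˡ → r<B ; m-setaʳ → j<B }) ∷ []

data Unary : Set where
  negation inversion : Unary

unaryTerm : ∀ {n} → Unary → Term n → Term n
unaryTerm negation  t = ⊖ t
unaryTerm inversion t = t ⁻¹ᵗ

applyUnary : Unary → Maybe ℕ → List Assignment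
applyUnary negation  (just j) = setai j ∷ []
applyUnary inversion (just j) = setmi j ∷ []
applyUnary _         nothing  = []

applyUnary-bounded : ∀ {n} u {reg} → Maybe.All (_< n) reg → BoundedCode n (applyUnary u reg)
applyUnary-bounded negation  (just j<n) = (λ { m-setai → j<n }) ∷ []
applyUnary-bounded inversion (just j<n) = (λ { m-setmi → j<n }) ∷ []
applyUnary-bounded negation  nothing    = []
applyUnary-bounded inversion nothing    = []

data Binary : Set where
  addition multiplication : Binary

binaryTerm : ∀ {n} → Binary → Term n → Term n → Term n
binaryTerm addition       = _⊕_
binaryTerm multiplication = _⊗_

-- a_r := a_r ∘ a_j, where a missing register stands for 0
absorb : Binary → ℕ → Maybe ℕ → List Assignment
absorb addition       r (just j) = seta r j ∷ []
absorb multiplication r (just j) = setm r j ∷ []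
absorb addition       r nothing  = []
absorb multiplication r nothing  = set0 r ∷ []

absorb-bounded : ∀ {B r} b {reg} → Maybe.All (_< B) reg → r < B → BoundedCode B (absorb b r reg)
absorb-bounded addition       (just j<B) r<B = (λ { m-setaˡ → r<B ; m-setaʳ → j<B }) ∷ []
absorb-bounded multiplication (just j<B) r<B = (λ { m-setmˡ → r<B ; m-setmʳ → j<B }) ∷ []
absorb-bounded addition       nothing    r<B = []
absorb-bounded multiplication nothing    r<B = (λ { m-set0 → r<B }) ∷ []

straight : List Assignment → Thread → Thread
straight as T = foldr (λ a → ⌜ a ⌝ ∘ᵗ_) T as

emit : Maybe ℕ → Thread
emit (just j) = ycp j ∘ᵗ S
emit nothing  = S

straight-testFree : ∀ as {T} → TestFree T → TestFree (straight as T)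
straight-testFree []       tf = tf
straight-testFree (a ∷ as) tf = tf-∘ (straight-testFree as tf)

emit-testFree : ∀ reg → TestFree (emit reg)
emit-testFree (just j) = tf-∘ tf-S
emit-testFree nothing  = tf-S

straight-bounded : ∀ {n as T i} → BoundedCode n as → (OccursAux i T → i < n) →
                   OccursAux i (straight as T) → i < n
straight-bounded []       bT o         = bT o
straight-bounded (b ∷ bs) bT (here m)  = b m
straight-bounded (b ∷ bs) bT (left o)  = straight-bounded bs bT o
straight-bounded (b ∷ bs) bT (right o) = straight-bounded bs bT o

emit-bounded : ∀ {n reg i} → Maybe.All (_< n) reg → OccursAux i (emit reg) → i < n
emit-bounded (just j<n) (here m-ycp) = j<n
emit-bounded (just j<n) (left ())
emit-bounded (just j<n) (right ())

clear-occurs : ∀ n {as T i} → i < n → OccursAux i (straight (clear n ++ as) T)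
clear-occurs (suc n) (s≤s i≤n) with m≤n⇒m<n∨m≡n i≤n
... | inj₁ i<n  = left (clear-occurs n i<n)
... | inj₂ refl = here m-set0

actions : Thread → List Action
actions (T ⊴ a ⊵ _) = a ∷ actions T
actions S           = []
actions D           = []

actions-bounded : ∀ {n T} → TestFree T → (∀ {i} → OccursAux i T → i < n) → All (Bounded n) (actions T)
actions-bounded tf-S     bT = []
actions-bounded tf-D     bT = []
actions-bounded (tf-∘ tf) bT = (bT ∘ here) ∷ actions-bounded tf (bT ∘ left)

data Kind : Action → Set where
  assignment : (a : Assignment) → Kind ⌜ a ⌝
  output     : (j : ℕ) → Kind (ycp j)
  test       : (i : ℕ) → Kind (test0 i)

kind : (a : Action) → Kind a
kind (cp i j)   = assignment (cp i j)
kind (set0 i)   = assignment (set0 i)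
kind (set1 i)   = assignment (set1 i)
kind (setai i)  = assignment (setai i)
kind (setmi i)  = assignment (setmi i)
kind (seta i j) = assignment (seta i j)
kind (setm i j) = assignment (setm i j)
kind (ycp j)    = output j
kind (test0 i)  = test i

assignments : List Action → List Assignment
assignments []       = []
assignments (a ∷ as) with kind a
... | assignment b = b ∷ assignments as
... | output _     = assignments as
... | test _       = assignments as

assignments-bounded : ∀ {n} as → All (Bounded n) as → BoundedCode n (assignments as)
assignments-bounded []       []       = []
assignments-bounded (a ∷ as) (b ∷ bs) with kind a
... | assignment _ = b ∷ assignments-bounded as bs
... | output _     = assignments-bounded as bs
... | test _       = assignments-bounded as bs

data Silent : Action → Set where
  assignment : (a : Assignment) → Silent ⌜ a ⌝
  test       : (i : ℕ) → Silent (test0 i)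

data LastOutput : List Action → Set where
  silent : ∀ {as} → All Silent as → LastOutput as
  output : ∀ pre j {post} → All Silent post → LastOutput (pre ++ ycp j ∷ post)

lastOutput : (as : List Action) → LastOutput as
lastOutput []       = silent []
lastOutput (a ∷ as) with lastOutput as
... | output pre j s = output (a ∷ pre) j s
... | silent s with kind a
...   | assignment b = silent (assignment b ∷ s)
...   | output j     = output [] j s
...   | test i       = silent (test i ∷ s)

module Execution {c} (M : CancellationMeadow c) where
  open CancellationMeadow M
  open Semantics M
  open IsCommutativeRing isCommutativeRing
    using (+-comm; *-comm; +-identityˡ; +-identityʳ; zeroʳ; -‿inverseʳ)
  open ≡-Reasoning

  -‿zero : - 0# ≡ 0#
  -‿zero = trans (sym (+-identityˡ (- 0#))) (-‿inverseʳ 0#)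

  ⁻¹‿zero : 0# ⁻¹ ≡ 0#
  ⁻¹‿zero = begin
    0# ⁻¹                         ≡⟨ sym (ril (0# ⁻¹)) ⟩
    0# ⁻¹ * (0# ⁻¹ * 0# ⁻¹ ⁻¹)    ≡⟨ cong (λ z → 0# ⁻¹ * (0# ⁻¹ * z)) (⁻¹-involutive 0#) ⟩
    0# ⁻¹ * (0# ⁻¹ * 0#)          ≡⟨ cong (0# ⁻¹ *_) (zeroʳ _) ⟩
    0# ⁻¹ * 0#                    ≡⟨ zeroʳ _ ⟩
    0#                            ∎

  upd-same : ∀ f i v → upd f i v i ≡ v
  upd-same f i v with i ≟ i
  ... | yes _   = refl
  ... | no i≢i = ⊥-elim (i≢i refl)

  upd-other : ∀ f {i j} v → j ≢ i → upd f i v j ≡ f j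
  upd-other f {i} {j} v j≢i with j ≟ i
  ... | yes j≡i = ⊥-elim (j≢i j≡i)
  ... | no _    = refl

  value : Assignment → State → Carrier
  value (cp _ j)   σ = xv σ j
  value (seta i j) σ = av σ i + av σ j
  value (setm i j) σ = av σ i * av σ j
  value (set0 _)   σ = 0#
  value (set1 _)   σ = 1#
  value (setai i)  σ = - av σ i
  value (setmi i)  σ = av σ i ⁻¹

  effect-assignment : ∀ a σ → effect ⌜ a ⌝ σ ≡ setA σ (target a) (value a σ)
  effect-assignment (cp i j)   σ = refl
  effect-assignment (seta i j) σ = refl
  effect-assignment (setm i j) σ = refl
  effect-assignment (set0 i)   σ = refl
  effect-assignment (set1 i)   σ = refl
  effect-assignment (setai i)  σ = refl
  effect-assignment (setmi i)  σ = refl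

  assignment-reply : ∀ a {σ} → Reply ⌜ a ⌝ σ true
  assignment-reply (cp i j)   = r-cp
  assignment-reply (seta i j) = r-seta
  assignment-reply (setm i j) = r-setm
  assignment-reply (set0 i)   = r-set0
  assignment-reply (set1 i)   = r-set1
  assignment-reply (setai i)  = r-setai
  assignment-reply (setmi i)  = r-setmi

  inputs-toℕ : ∀ {n} (m : Fin n → Carrier) i → inputs m (Fin.toℕ i) ≡ m i
  inputs-toℕ m Fin.zero    = refl
  inputs-toℕ m (Fin.suc i) = inputs-toℕ (m ∘ Fin.suc) i

  exec : List Action → State → State
  exec as σ = foldl (λ σ a → effect a σ) σ as

  run : List Assignment → State → State
  run as σ = foldl (λ σ a → effect ⌜ a ⌝ σ) σ as

  run-++ : ∀ as bs σ → run (as ++ bs) σ ≡ run bs (run as σ)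
  run-++ as bs σ = foldl-++ (λ σ a → effect ⌜ a ⌝ σ) σ as bs

  run-inputs : ∀ as σ → xv (run as σ) ≡ xv σ
  run-inputs []       σ = refl
  run-inputs (a ∷ as) σ = trans (run-inputs as _) (cong xv (effect-assignment a σ))

  run-output : ∀ as σ → yv (run as σ) ≡ yv σ
  run-output []       σ = refl
  run-output (a ∷ as) σ = trans (run-output as _) (cong yv (effect-assignment a σ))

  run-frame : ∀ {n r} as → BoundedCode n as → n ≤ r → ∀ σ → av (run as σ) r ≡ av σ r
  run-frame         []       []       n≤r σ = refl
  run-frame {r = r} (a ∷ as) (b ∷ bs) n≤r σ = begin
    av (run as (effect ⌜ a ⌝ σ)) r      ≡⟨ run-frame as bs n≤r _ ⟩
    av (effect ⌜ a ⌝ σ) r               ≡⟨ cong (λ τ → av τ r) (effect-assignment a σ) ⟩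
    upd (av σ) (target a) (value a σ) r ≡⟨ upd-other (av σ) _ r≢target ⟩
    av σ r                              ∎
    where r≢target = <⇒≢ (<-≤-trans (target-bounded a b) n≤r) ∘ sym

  exec-++ : ∀ as bs σ → exec (as ++ bs) σ ≡ exec bs (exec as σ)
  exec-++ as bs σ = foldl-++ (λ σ a → effect a σ) σ as bs

  exec-silent : ∀ {as} → All Silent as → ∀ σ → yv (exec as σ) ≡ yv σ
  exec-silent []                   σ = refl
  exec-silent (assignment a ∷ s) σ = trans (exec-silent s _) (cong yv (effect-assignment a σ))
  exec-silent (test i ∷ s)       σ = exec-silent s σ

  run-testFree : ∀ {T σ σ′} → TestFree T → Run T σ σ′ → σ′ ≡ exec (actions T) σ
  run-testFree tf-S     run-S       = refl
  run-testFree tf-D     ()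
  run-testFree (tf-∘ tf) (run-t _ r) = run-testFree tf r
  run-testFree (tf-∘ tf) (run-f _ r) = run-testFree tf r

  run-straight : ∀ as {T σ σ′} → Run T (run as σ) σ′ → Run (straight as T) σ σ′
  run-straight []       r = r
  run-straight (a ∷ as) r = run-t (assignment-reply a) (run-straight as r)

  record Agree (n : ℕ) (σ τ : State) : Set c where
    constructor _,_
    field
      agree-inputs : xv σ ≡ xv τ
      agree-below  : ∀ {i} → i < n → av σ i ≡ av τ i
  open Agree public

  value-agree : ∀ {n σ τ} a → Bounded n ⌜ a ⌝ → Agree n σ τ → value a σ ≡ value a τ
  value-agree (cp i j)   b (x≡ , _)  = cong (λ f → f j) x≡
  value-agree (seta i j) b (_ , a≡)  = cong₂ _+_ (a≡ (b m-setaˡ)) (a≡ (b m-setaʳ))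
  value-agree (setm i j) b (_ , a≡)  = cong₂ _*_ (a≡ (b m-setmˡ)) (a≡ (b m-setmʳ))
  value-agree (set0 i)   b _         = refl
  value-agree (set1 i)   b _         = refl
  value-agree (setai i)  b (_ , a≡)  = cong -_ (a≡ (b m-setai))
  value-agree (setmi i)  b (_ , a≡)  = cong _⁻¹ (a≡ (b m-setmi))

  setA-agree : ∀ {n σ τ i v w} → v ≡ w → Agree n σ τ → Agree n (setA σ i v) (setA τ i w)
  setA-agree {n} {σ} {τ} {i} {v} {w} v≡w (x≡ , a≡) = x≡ , agree-upd
    where
    agree-upd : ∀ {j} → j < n → upd (av σ) i v j ≡ upd (av τ) i w j
    agree-upd {j} j<n with j ≟ i
    ... | yes _ = v≡w
    ... | no _  = a≡ j<n

  effect-agree : ∀ {n σ τ} a → Bounded n ⌜ a ⌝ → Agree n σ τ →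
                 Agree n (effect ⌜ a ⌝ σ) (effect ⌜ a ⌝ τ)
  effect-agree {σ = σ} {τ} a b ag
    rewrite effect-assignment a σ | effect-assignment a τ = setA-agree {i = target a} (value-agree a b ag) ag

  simulate : ∀ {n} as → All (Bounded n) as → ∀ {σ τ} → Agree n σ τ →
             Agree n (exec as σ) (run (assignments as) τ)
  simulate []       []       ag = ag
  simulate (a ∷ as) (b ∷ bs) ag@(x≡ , a≡) with kind a
  ... | assignment a′ = simulate as bs (effect-agree a′ b ag)
  ... | output _      = simulate as bs (x≡ , a≡)
  ... | test _        = simulate as bs ag

  record Clean {k} (m : Fin (suc k) → Carrier) (n : ℕ) (τ : State) : Set c where
    constructor _,_
    field
      clean-inputs : xv τ ≡ inputs m
      clean-below  : ∀ {i} → i < n → av τ i ≡ 0#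
  open Clean public

  Clean-weaken : ∀ {k} {m : Fin (suc k) → Carrier} {n B τ} → n ≤ B → Clean m B τ → Clean m n τ
  Clean-weaken n≤B (x≡ , zeros) = x≡ , λ i<n → zeros (<-≤-trans i<n n≤B)

  initial-agree : ∀ {k} {m : Fin (suc k) → Carrier} {n τ} → Clean m n τ → Agree n (initial m) τ
  initial-agree (x≡ , zeros) = sym x≡ , sym ∘ zeros

  clear-clean : ∀ {k} {m : Fin (suc k) → Carrier} n {τ} → xv τ ≡ inputs m → Clean m n (run (clear n) τ)
  clear-clean zero          x≡ = x≡ , λ ()
  clear-clean (suc n) {τ}   x≡ = clean-inputs clean , cleared
    where
    clean = clear-clean n {setA τ n 0#} x≡
    cleared : ∀ {i} → i < suc n → _
    cleared (s≤s i≤n) with m≤n⇒m<n∨m≡n i≤n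
    ... | inj₁ i<n  = clean-below clean i<n
    ... | inj₂ refl = trans (run-frame (clear n) (clear-bounded n ≤-refl) ≤-refl _) (upd-same (av τ) n 0#)

  Holds : Maybe ℕ → State → Carrier → Set c
  Holds (just j) τ v = av τ j ≡ v
  Holds nothing  τ v = v ≡ 0#

  straight-emit : ∀ as {reg σ v} → Holds reg (run as σ) v → yv σ ≡ 0# →
                  Σ State λ σ′ → Run (straight as (emit reg)) σ σ′ × yv σ′ ≡ v
  straight-emit as {just j}      holds y≡0 = _ , run-straight as (run-t r-ycp run-S) , holds
  straight-emit as {nothing} {σ} holds y≡0 =
    _ , run-straight as run-S , trans (run-output as σ) (trans y≡0 (sym holds))

  transfer-holds : ∀ r {reg τ v} → Holds reg τ v → av (run (transfer r reg) τ) r ≡ v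
  transfer-holds r {nothing}  {τ} holds = trans (upd-same (av τ) r 0#) (sym holds)
  transfer-holds r {just j}   {τ} holds with j ≟ r
  ... | yes refl = holds
  ... | no j≢r   = begin
    upd τ₀ r (τ₀ r + τ₀ j) r ≡⟨ upd-same τ₀ r _ ⟩
    τ₀ r + τ₀ j              ≡⟨ cong₂ _+_ (upd-same (av τ) r 0#) (upd-other (av τ) 0# j≢r) ⟩
    0# + av τ j              ≡⟨ +-identityˡ _ ⟩
    av τ j                   ≡⟨ holds ⟩
    _                        ∎
    where τ₀ = upd (av τ) r 0#

  module _ {k} (m : Fin (suc k) → Carrier) where

    applyUnary-holds : ∀ u {reg τ} (t : Term (suc k)) → Holds reg τ (eval M t m) →
                       Holds reg (run (applyUnary u reg) τ) (eval M (unaryTerm u t) m)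
    applyUnary-holds negation  {just j}  {τ} t holds = trans (upd-same (av τ) j _) (cong -_ holds)
    applyUnary-holds inversion {just j}  {τ} t holds = trans (upd-same (av τ) j _) (cong _⁻¹ holds)
    applyUnary-holds negation  {nothing}     t holds = trans (cong -_ holds) -‿zero
    applyUnary-holds inversion {nothing}     t holds = trans (cong _⁻¹ holds) ⁻¹‿zero

    absorb-holds : ∀ b r {reg τ} (t u : Term (suc k)) → av τ r ≡ eval M t m → Holds reg τ (eval M u m) →
                   av (run (absorb b r reg) τ) r ≡ eval M (binaryTerm b t u) m
    absorb-holds addition       r {just j}  {τ} t u r≡ holds = trans (upd-same (av τ) r _) (cong₂ _+_ r≡ holds)
    absorb-holds multiplication r {just j}  {τ} t u r≡ holds = trans (upd-same (av τ) r _) (cong₂ _*_ r≡ holds)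
    absorb-holds addition       r {nothing}     t u r≡ holds =
      trans r≡ (trans (sym (+-identityʳ _)) (cong (eval M t m +_) (sym holds)))
    absorb-holds multiplication r {nothing} {τ} t u r≡ holds =
      trans (upd-same (av τ) r 0#) (trans (sym (zeroʳ _)) (cong (eval M t m *_) (sym holds)))

    binaryTerm-comm : ∀ b (t u : Term (suc k)) → eval M (binaryTerm b t u) m ≡ eval M (binaryTerm b u t) m
    binaryTerm-comm addition       t u = +-comm _ _
    binaryTerm-comm multiplication t u = *-comm _ _

module _ {c : Level} {k : ℕ} where

  Loads : ℕ → Term (suc k) → List Assignment → Maybe ℕ → Set (Level.suc c)
  Loads n t code register =
    (M : CancellationMeadow c) (m : Fin (suc k) → CancellationMeadow.Carrier M) →
    ∀ τ → Execution.Clean M m n τ → Execution.Holds M register (Execution.run M code τ) (eval M t m)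

  Outputs : List Action → Term (suc k) → Set (Level.suc c)
  Outputs as t = (M : CancellationMeadow c) (m : Fin (suc k) → CancellationMeadow.Carrier M) →
                 Semantics.yv (Execution.exec M as (Semantics.initial M m)) ≡ eval M t m

  record Loader (n : ℕ) (t : Term (suc k)) : Set (Level.suc c) where
    field
      code             : List Assignment
      register         : Maybe ℕ
      code-bounded     : BoundedCode n code
      register-bounded : Maybe.All (_< n) register
      loads            : Loads n t code register

  open Loader

  program-loader : ∀ {n t} as → All (Bounded n) as → Outputs as t → Loader n t
  program-loader {n} {t} as bounded outputs with lastOutput as
  ... | silent s = record
    { code = [] ; register = nothing ; code-bounded = [] ; register-bounded = nothing
    ; loads = λ M m τ _ → trans (sym (outputs M m)) (Execution.exec-silent M s _) }
  ... | output pre j {post} s with ++⁻ pre bounded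
  ...   | pre-bounded , j-bounded ∷ _ = record
    { code = assignments pre ; register = just j
    ; code-bounded = assignments-bounded pre pre-bounded ; register-bounded = just j<n
    ; loads = loads′ }
    where
    j<n = j-bounded m-ycp

    loads′ : Loads n t (assignments pre) (just j)
    loads′ M m τ clean = begin
      av (run (assignments pre) τ) j
        ≡⟨ sym (agree-below (simulate pre pre-bounded (initial-agree clean)) j<n) ⟩
      av (exec pre (initial m)) j
        ≡⟨ sym (exec-silent s _) ⟩
      yv (exec post (effect (ycp j) (exec pre (initial m))))
        ≡⟨ cong yv (sym (exec-++ pre (ycp j ∷ post) _)) ⟩
      yv (exec (pre ++ ycp j ∷ post) (initial m))
        ≡⟨ outputs M m ⟩
      eval M t m ∎
      where
      open Semantics M
      open Execution M
      open ≡-Reasoning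

  loader : ∀ {n} t → ComputableWith c k n t → Loader n t
  loader t (T , tf , uses , computes) =
    program-loader (actions T) (actions-bounded tf (Equivalence.to (uses _))) outputs
    where
    outputs : Outputs (actions T) t
    outputs M m with computes M m
    ... | σ′ , r , y≡ = trans (cong Semantics.yv (sym (Execution.run-testFree M tf r))) y≡

  computable : ∀ {n t} → Loader n t → ComputableWith c k n t
  computable {n} {t} L =
    thread , straight-testFree (clear n ++ code L) (emit-testFree (register L)) , uses , denotes
    where
    thread = straight (clear n ++ code L) (emit (register L))

    uses : UsesAux n thread
    uses i = mk⇔ (straight-bounded (++⁺ (clear-bounded n ≤-refl) (code-bounded L))
                                  (emit-bounded (register-bounded L)))
                 (clear-occurs n)

    denotes : Computes c k thread t
    denotes M m = straight-emit (clear n ++ code L) loaded refl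
      where
      open Execution M
      loaded : Holds (register L) (run (clear n ++ code L) (Semantics.initial M m)) (eval M t m)
      loaded = subst (λ σ → Holds (register L) σ (eval M t m)) (sym (run-++ (clear n) (code L) _))
                     (loads L M m _ (clear-clean n refl))

  var-loader : ∀ i → Loader 1 (var i)
  var-loader i = record
    { code = cp 0 (Fin.toℕ i) ∷ [] ; register = just 0
    ; code-bounded = (λ { m-cp → s≤s z≤n }) ∷ [] ; register-bounded = just (s≤s z≤n)
    ; loads = λ M m τ clean → let open Execution M in
        trans (upd-same (Semantics.av τ) 0 _)
              (trans (cong (λ f → f (Fin.toℕ i)) (clean-inputs clean)) (inputs-toℕ m i)) }

  zero-loader : Loader 1 𝟎
  zero-loader = record
    { code = [] ; register = nothing ; code-bounded = [] ; register-bounded = nothing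
    ; loads = λ M m τ _ → refl }

  one-loader : Loader 1 𝟏
  one-loader = record
    { code = set1 0 ∷ [] ; register = just 0
    ; code-bounded = (λ { m-set1 → s≤s z≤n }) ∷ [] ; register-bounded = just (s≤s z≤n)
    ; loads = λ M m τ _ → Execution.upd-same M (Semantics.av τ) 0 _ }

  unary-loader : ∀ u {n t} → Loader n t → Loader n (unaryTerm u t)
  unary-loader u {t = t} L = record
    { code = code L ++ applyUnary u (register L) ; register = register L
    ; code-bounded = ++⁺ (code-bounded L) (applyUnary-bounded u (register-bounded L))
    ; register-bounded = register-bounded L
    ; loads = λ M m τ clean → let open Execution M in
        subst (λ σ → Holds (register L) σ _) (sym (run-++ (code L) _ τ))
          (applyUnary-holds m u t (loads L M m τ clean)) }

  loader-cong : ∀ {n t u} → (∀ M m → eval M t m ≡ eval M u m) → Loader n t → Loader n u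
  loader-cong t≡u L = record
    { code = code L ; register = register L
    ; code-bounded = code-bounded L ; register-bounded = register-bounded L
    ; loads = λ M m τ clean → subst (Execution.Holds M _ _) (t≡u M m) (loads L M m τ clean) }

  combine : ∀ b {n₁ n₂ r t₁ t₂} → n₁ ≤ suc r → n₂ ≤ r → Loader n₁ t₁ → Loader n₂ t₂ →
            Loader (suc r) (binaryTerm b t₁ t₂)
  combine b {n₁} {n₂} {r} {t₁} {t₂} n₁≤ n₂≤r L₁ L₂ = record
    { code = combined
    ; register = just r
    ; code-bounded =
        ++⁺ (BoundedCode-weaken n₁≤ (code-bounded L₁))
        (++⁺ (transfer-bounded (Maybe.map (λ j< → <-≤-trans j< n₁≤) (register-bounded L₁)) ≤-refl)
        (++⁺ (clear-bounded n₂ n₂≤B)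
        (++⁺ (BoundedCode-weaken n₂≤B (code-bounded L₂))
             (absorb-bounded b (Maybe.map (λ j< → <-≤-trans j< n₂≤B) (register-bounded L₂)) ≤-refl))))
    ; register-bounded = just ≤-refl
    ; loads = loads′ }
    where
    combined = code L₁ ++ transfer r (register L₁) ++ clear n₂ ++ code L₂ ++ absorb b r (register L₂)

    n₂≤B : n₂ ≤ suc r
    n₂≤B = ≤-trans n₂≤r (n≤1+n r)

    loads′ : Loads (suc r) (binaryTerm b t₁ t₂) combined (just r)
    loads′ M m τ clean = begin
      av (run combined τ) r
        ≡⟨ cong (λ σ → av σ r) splits ⟩
      av (run (absorb b r (register L₂)) τ₄) r
        ≡⟨ absorb-holds m b r t₁ t₂ r≡ (loads L₂ M m τ₃ clean₃) ⟩
      eval M (binaryTerm b t₁ t₂) m ∎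
      where
      open Semantics M
      open Execution M
      open ≡-Reasoning
      τ₁ = run (code L₁) τ
      τ₂ = run (transfer r (register L₁)) τ₁
      τ₃ = run (clear n₂) τ₂
      τ₄ = run (code L₂) τ₃
      splits : run combined τ ≡ run (absorb b r (register L₂)) τ₄
      splits = trans (run-++ (code L₁) _ τ) (trans (run-++ (transfer r (register L₁)) _ τ₁)
                 (trans (run-++ (clear n₂) _ τ₂) (run-++ (code L₂) _ τ₃)))
      clean₃ : Clean m n₂ τ₃
      clean₃ = clear-clean n₂ (trans (run-inputs (transfer r (register L₁)) τ₁)
                                     (trans (run-inputs (code L₁) τ) (clean-inputs clean)))
      -- a_r lies above every variable of the second loader
      r≡ : av τ₄ r ≡ eval M t₁ m
      r≡ = trans (run-frame (code L₂) (code-bounded L₂) n₂≤r τ₃)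
           (trans (run-frame (clear n₂) (clear-bounded n₂ ≤-refl) n₂≤r τ₂)
           (transfer-holds r (loads L₁ M m τ (Clean-weaken n₁≤ clean))))

  combine-< : ∀ b {n m t t′} → n < m → Loader n t → Loader m t′ → Loader m (binaryTerm b t′ t)
  combine-< b (s≤s n≤r) L L′ = combine b ≤-refl n≤r L′ L

  unequal-loader : ∀ b {n m t t′} → n ≢ m → Loader n t → Loader m t′ →
                   Loader (n ⊔ m) (binaryTerm b t t′)
  unequal-loader b {n} {m} n≢m L L′ with <-cmp n m
  ... | tri≈ _ n≡m _ = ⊥-elim (n≢m n≡m)
  ... | tri< n<m _ _ = subst (λ B → Loader B _) (sym (m≤n⇒m⊔n≡n (<⇒≤ n<m)))
                         (loader-cong (λ M ρ → Execution.binaryTerm-comm M ρ b _ _) (combine-< b n<m L L′))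
  ... | tri> _ _ m<n = subst (λ B → Loader B _) (sym (m≥n⇒m⊔n≡m (<⇒≤ m<n))) (combine-< b m<n L′ L)

mainTheorem12 : (c : Level) (k : ℕ) →
    (((i : Fin (suc k)) → ComputableWith c k 1 (var i))
      × ComputableWith c k 1 𝟎
      × ComputableWith c k 1 𝟏)
    × (∀ n (t : Term (suc k)) → ComputableWith c k n t →
        ComputableWith c k n (⊖ t) × ComputableWith c k n (t ⁻¹ᵗ))
    × (∀ n m (t t′ : Term (suc k)) →
        ComputableWith c k n t → ComputableWith c k m t′ →
        (n ≡ m → ComputableWith c k (suc n) (t ⊕ t′) × ComputableWith c k (suc n) (t ⊗ t′))
        × (¬ (n ≡ m) → ComputableWith c k (n ⊔ m) (t ⊕ t′) × ComputableWith c k (n ⊔ m) (t ⊗ t′)))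
mainTheorem12 c k =
  ( (λ i → computable (var-loader i)) , computable zero-loader , computable one-loader )
  , (λ n t h → computable (unary-loader negation (loader t h)) , computable (unary-loader inversion (loader t h)))
  , λ n m t t′ h h′ →
      (λ { refl → both λ b → combine b (n≤1+n n) ≤-refl (loader t h) (loader t′ h′) })
      , λ n≢m → both λ b → unequal-loader b n≢m (loader t h) (loader t′ h′)
  where
  both : ∀ {n t t′} → (∀ b → Loader {c} n (binaryTerm b t t′)) →
         ComputableWith c k n (t ⊕ t′) × ComputableWith c k n (t ⊗ t′)
  both L = computable (L addition) , computable (L multiplication)
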